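{- Let $G$ be a strongly connected tournament with $|V(G)|\ge 3$ such that $V(G)$ can be partitioned into sets $X$, $Y$, $Z$ with $X\cup Y$, $Y\cup Z$, $Z\cup X$ each transitive. Write $X=\{x_1,\dots,x_\ell\}$, $Y=\{y_1,\dots,y_m\}$, $Z=\{z_1,\dots,z_n\}$ where $x_i\rightarrow x_j$ whenever $i<j$, and similarly for $Y$ and $Z$. Then there exists a sequence $C_1, C_2,\dots,C_{|V(G)|-2}$ of cyclic triangles of $G$ such that $C_1=\{x_1,y_1,z_1\}$, and for each $1\le r<|V(G)|-2$, if $C_r=\{x_i,y_j,z_k\}$ then $C_{r+1}$ is one of $\{x_{i+1},y_j,z_k\}$, $\{x_i,y_{j+1},z_k\}$, or $\{x_i,y_j,z_{k+1}\}$.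
   Context: A tournament is a finite loopless directed graph in which for any two distinct vertices $u,v$ there is exactly one edge between them; write $u\rightarrow v$ for the edge from $u$ to $v$. A cyclic triangle is a set $\{a,b,c\}$ of three distinct vertices with $a\rightarrow b\rightarrow c\rightarrow a$. A set of vertices is transitive if the subtournament it induces contains no cyclic triangle (equivalently its vertices can be ordered so that earlier vertices point to later ones). -}

module Defs where

open import Data.Nat using (ℕ; zero; suc; _<_; _≤_; _∸_)
open import Data.Fin using (Fin; fromℕ<)
open import Data.Bool using (Bool; true; false; not; T)
open import Data.Product using (Σ; _×_; _,_; ∃)
open import Data.Sum using (_⊎_)
open import Relation.Binary.PropositionalEquality using (_≡_; _≢_)
open import Relation.Nullary using (¬_)
open import Relation.Binary.Construct.Closure.ReflexiveTransitive using (Star)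

record Tournament (N : ℕ) : Set where
  field
    E          : Fin N → Fin N → Bool
    loopless   : ∀ u → E u u ≡ false
    tournament : ∀ u v → u ≢ v → E u v ≡ not (E v u)

module _ {N : ℕ} (G : Tournament N) where
  open Tournament G

  _⇒_ : Fin N → Fin N → Set
  u ⇒ v = T (E u v)

  Cycle3 : Fin N → Fin N → Fin N → Set
  Cycle3 a b c = (a ⇒ b) × (b ⇒ c) × (c ⇒ a)

  CyclicTriangle : Fin N → Fin N → Fin N → Set
  CyclicTriangle a b c = Cycle3 a b c ⊎ Cycle3 a c b

  StronglyConnected : Set
  StronglyConnected = ∀ u v → Star _⇒_ u v

  TransitiveSet : (Fin N → Set) → Set
  TransitiveSet S = ∀ a b c → S a → S b → S c → ¬ Cycle3 a b c

_∪_ : {N : ℕ} → (Fin N → Set) → (Fin N → Set) → Fin N → Set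
(S ∪ T′) v = S v ⊎ T′ v

Partition3 : {N : ℕ} → (Fin N → Set) → (Fin N → Set) → (Fin N → Set) → Set
Partition3 X Y Z =
  (∀ v → X v ⊎ Y v ⊎ Z v) ×
  (∀ v → X v → Y v → Data.Empty.⊥) ×
  (∀ v → Y v → Z v → Data.Empty.⊥) ×
  (∀ v → Z v → X v → Data.Empty.⊥)
  where import Data.Empty

module _ {N : ℕ} (G : Tournament N) where
  -- x : Fin ℓ → Fin N enumerates the set X as x_1,...,x_ℓ (0-indexed here)
  -- with x_i → x_j whenever i < j
  OrderedEnumeration : {ℓ : ℕ} → (Fin N → Set) → (Fin ℓ → Fin N) → Set
  OrderedEnumeration {ℓ} X x =
    (∀ i → X (x i)) ×
    (∀ v → X v → ∃ λ i → x i ≡ v) ×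
    (∀ (i j : Fin ℓ) → Data.Fin._<_ i j → _⇒_ G (x i) (x j))
    where import Data.Fin

  -- the index triple (i,j,k) (0-indexed) is in range and {x_i, y_j, z_k} is a cyclic triangle
  CyclicAt : {ℓ m n : ℕ} → (Fin ℓ → Fin N) → (Fin m → Fin N) → (Fin n → Fin N)
           → ℕ × ℕ × ℕ → Set
  CyclicAt {ℓ} {m} {n} x y z (i , j , k) =
    Σ (i < ℓ) λ i< → Σ (j < m) λ j< → Σ (k < n) λ k< →
      CyclicTriangle G (x (fromℕ< i<)) (y (fromℕ< j<)) (z (fromℕ< k<))

Step : ℕ × ℕ × ℕ → ℕ × ℕ × ℕ → Set
Step (i , j , k) t = (t ≡ (suc i , j , k)) ⊎ (t ≡ (i , suc j , k)) ⊎ (t ≡ (i , j , suc k))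

-- Since the union of any two parts is transitive, edges between two parts are monotone in the
-- positions: if x_i → y_j then x_i′ → y_j′ whenever i′ ≤ i and j ≤ j′.  By monotonicity, a first
-- vertex beaten by no other first vertex would have no in-neighbour at all, so the first vertices
-- form a cyclic triangle.  From a cyclic triangle {x_i, y_j, z_k}, if no single advance stays
-- cyclic, monotonicity shows that no edge enters the set of vertices at positions ≤ i+1, ≤ j+1,
-- ≤ k+1; by strong connectivity this set is everything, so no part can advance.  Counting vertices,
-- some part can advance as long as i + j + k + 3 < |V(G)|.
module Submission where

open import Defs
open import Data.Nat using (ℕ; zero; suc; _+_; _<_; _≤_; _∸_; z≤n; s≤s; _<?_)
open import Data.Nat.Properties
  using ( ≤-refl; ≤-trans; ≤-reflexive; <-≤-trans; ≤-<-trans; ≮⇒≥; <⇒≱; n≮0; n≤1+n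
        ; m≤n⇒m<n∨m≡n; <-cmp; +-suc; +-mono-≤)
open import Data.Fin as F using (Fin; toℕ; fromℕ<; splitAt; _↑ˡ_; _↑ʳ_; punchIn)
open import Data.Fin.Properties
  using (toℕ-fromℕ<; toℕ-injective; toℕ<n; injective⇒≤; splitAt-↑ˡ; splitAt-↑ʳ; punchInᵢ≢i)
  renaming (_≟_ to _≟ᶠ_)
open import Data.Bool using (true; false; not; T)
open import Data.Unit using (tt)
open import Data.Empty using (⊥-elim)
open import Data.Product using (Σ; ∃; ∃₂; _×_; _,_; proj₁; proj₂)
open import Data.Sum using (_⊎_; inj₁; inj₂; [_,_]′; swap)
open import Function using (_∘_; id)
open import Relation.Binary.Definitions using (DecidableEquality; tri<; tri≈; tri>)
open import Relation.Binary.PropositionalEquality using (_≡_; _≢_; refl; sym; trans; cong; subst)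
open import Relation.Nullary using (¬_; yes; no)
open import Relation.Binary.Construct.Closure.ReflexiveTransitive using (Star; ε; _◅_; reverse)

data Part : Set where
  𝒳 𝒴 𝒵 : Part

_≟_ : DecidableEquality Part
𝒳 ≟ 𝒳 = yes refl
𝒴 ≟ 𝒴 = yes refl
𝒵 ≟ 𝒵 = yes refl
𝒳 ≟ 𝒴 = no λ ()
𝒳 ≟ 𝒵 = no λ ()
𝒴 ≟ 𝒳 = no λ ()
𝒴 ≟ 𝒵 = no λ ()
𝒵 ≟ 𝒳 = no λ ()
𝒵 ≟ 𝒴 = no λ ()

data Orientation : Set where
  clockwise anticlockwise : Orientation

turn : Orientation → Part → Part
turn clockwise     𝒳 = 𝒴
turn clockwise     𝒴 = 𝒵
turn clockwise     𝒵 = 𝒳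
turn anticlockwise 𝒳 = 𝒵
turn anticlockwise 𝒴 = 𝒳
turn anticlockwise 𝒵 = 𝒴

turn-irrefl : ∀ o p → turn o p ≢ p
turn-irrefl clockwise     𝒳 ()
turn-irrefl clockwise     𝒴 ()
turn-irrefl clockwise     𝒵 ()
turn-irrefl anticlockwise 𝒳 ()
turn-irrefl anticlockwise 𝒴 ()
turn-irrefl anticlockwise 𝒵 ()

turn³ : ∀ o p → turn o (turn o (turn o p)) ≡ p
turn³ clockwise     𝒳 = refl
turn³ clockwise     𝒴 = refl
turn³ clockwise     𝒵 = refl
turn³ anticlockwise 𝒳 = refl
turn³ anticlockwise 𝒴 = refl
turn³ anticlockwise 𝒵 = refl

turn-injective : ∀ o {p q} → turn o p ≡ turn o q → p ≡ q
turn-injective o {p} {q} eq = trans (sym (turn³ o p)) (trans (cong (turn o ∘ turn o) eq) (turn³ o q))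

orbit-elim : ∀ o c {P : Part → Set} → P c → P (turn o c) → P (turn o (turn o c)) → ∀ p → P p
orbit-elim clockwise     𝒳 a b c = λ { 𝒳 → a ; 𝒴 → b ; 𝒵 → c }
orbit-elim clockwise     𝒴 a b c = λ { 𝒴 → a ; 𝒵 → b ; 𝒳 → c }
orbit-elim clockwise     𝒵 a b c = λ { 𝒵 → a ; 𝒳 → b ; 𝒴 → c }
orbit-elim anticlockwise 𝒳 a b c = λ { 𝒳 → a ; 𝒵 → b ; 𝒴 → c }
orbit-elim anticlockwise 𝒴 a b c = λ { 𝒴 → a ; 𝒳 → b ; 𝒵 → c }
orbit-elim anticlockwise 𝒵 a b c = λ { 𝒵 → a ; 𝒴 → b ; 𝒳 → c }

others-elim : ∀ c {P : Part → Set} → (∀ o → P (turn o c)) → ∀ q → q ≢ c → P q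
others-elim 𝒳 h = λ { 𝒳 c≢c → ⊥-elim (c≢c refl) ; 𝒴 _ → h clockwise ; 𝒵 _ → h anticlockwise }
others-elim 𝒴 h = λ { 𝒴 c≢c → ⊥-elim (c≢c refl) ; 𝒵 _ → h clockwise ; 𝒳 _ → h anticlockwise }
others-elim 𝒵 h = λ { 𝒵 c≢c → ⊥-elim (c≢c refl) ; 𝒳 _ → h clockwise ; 𝒴 _ → h anticlockwise }

adjacent : ∀ o {p q} → p ≢ q → q ≡ turn o p ⊎ p ≡ turn o q
adjacent o {p} {q} = orbit-elim o p {λ q → p ≢ q → q ≡ turn o p ⊎ p ≡ turn o q}
  (λ p≢p → ⊥-elim (p≢p refl)) (λ _ → inj₁ refl) (λ _ → inj₂ (sym (turn³ o p))) q

any-or-all : {A B : Part → Set} → (∀ p → A p ⊎ B p) → ∃ A ⊎ (∀ p → B p)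
any-or-all d with d 𝒳 | d 𝒴 | d 𝒵
... | inj₁ a | _      | _      = inj₁ (_ , a)
... | _      | inj₁ a | _      = inj₁ (_ , a)
... | _      | _      | inj₁ a = inj₁ (_ , a)
... | inj₂ a | inj₂ b | inj₂ c = inj₂ λ { 𝒳 → a ; 𝒴 → b ; 𝒵 → c }

total : (Part → ℕ) → ℕ
total t = t 𝒳 + (t 𝒴 + t 𝒵)

total-mono : ∀ {s t} → (∀ p → s p ≤ t p) → total s ≤ total t
total-mono s≤t = +-mono-≤ (s≤t 𝒳) (+-mono-≤ (s≤t 𝒴) (s≤t 𝒵))

total-suc : ∀ t → total (suc ∘ t) ≡ 3 + total t
total-suc t = cong suc (trans (+-suc (t 𝒳) _)
                             (cong suc (trans (cong (t 𝒳 +_) (+-suc (t 𝒴) _)) (+-suc (t 𝒳) _))))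

bump : Part → (Part → ℕ) → Part → ℕ
bump p t q with p ≟ q
... | yes _ = suc (t q)
... | no  _ = t q

bump-self : ∀ p t → bump p t p ≡ suc (t p)
bump-self p t with p ≟ p
... | yes _   = refl
... | no  p≢p = ⊥-elim (p≢p refl)

bump-other : ∀ {p q} t → p ≢ q → bump p t q ≡ t q
bump-other {p} {q} t p≢q with p ≟ q
... | yes p≡q = ⊥-elim (p≢q p≡q)
... | no  _   = refl

bump-≥ : ∀ p t q → t q ≤ bump p t q
bump-≥ p t q with p ≟ q
... | yes _ = n≤1+n (t q)
... | no  _ = ≤-refl

total-bump : ∀ p t → total (bump p t) ≡ suc (total t)
total-bump 𝒳 t = refl
total-bump 𝒴 t = +-suc (t 𝒳) _
total-bump 𝒵 t = trans (cong (t 𝒳 +_) (+-suc (t 𝒴) _)) (+-suc (t 𝒳) _)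

triple : (Part → ℕ) → ℕ × ℕ × ℕ
triple t = t 𝒳 , t 𝒴 , t 𝒵

bump-step : ∀ p t → Step (triple t) (triple (bump p t))
bump-step 𝒳 t = inj₁ refl
bump-step 𝒴 t = inj₂ (inj₁ refl)
bump-step 𝒵 t = inj₂ (inj₂ refl)

surjection⇒≥ : ∀ {m n} (f : Fin m → Fin n) → (∀ v → ∃ λ i → f i ≡ v) → n ≤ m
surjection⇒≥ f surj = injective⇒≤ {f = proj₁ ∘ surj}
  λ {v} {w} eq → trans (sym (proj₂ (surj v))) (trans (cong f eq) (proj₂ (surj w)))

another : ∀ {N} → 1 < N → (v : Fin N) → ∃ λ u → u ≢ v
another {suc zero}    (s≤s ()) _
another {suc (suc _)} _ v = punchIn v F.zero , punchInᵢ≢i v F.zero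

module _ {N : ℕ} (G : Tournament N) where
  open Tournament G

  private
    infix 4 _⟶_
    _⟶_ : Fin N → Fin N → Set
    _⟶_ = _⇒_ G

    exclusive : ∀ {a b} → a ≡ not b → T a → ¬ T b
    exclusive {b = true}  refl ()
    exclusive {b = false} _    _  ()

    exhaustive : ∀ {a b} → a ≡ not b → T a ⊎ T b
    exhaustive {b = true}  _    = inj₂ tt
    exhaustive {b = false} refl = inj₁ tt

  ⟶-irrefl : ∀ {u} → ¬ u ⟶ u
  ⟶-irrefl {u} = subst T (loopless u)

  ⟶-asym : ∀ {u v} → u ⟶ v → ¬ v ⟶ u
  ⟶-asym {u} {v} e with u ≟ᶠ v
  ... | yes refl = ⊥-elim (⟶-irrefl e)
  ... | no  u≢v  = exclusive (tournament u v u≢v) e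

  ⟶-connex : ∀ {u v} → u ≢ v → u ⟶ v ⊎ v ⟶ u
  ⟶-connex {u} {v} u≢v = exhaustive (tournament u v u≢v)

  InClosed : (Fin N → Set) → Set
  InClosed A = ∀ {u v} → u ⟶ v → A v → A u

  inClosed-full : StronglyConnected G → ∀ {A} → InClosed A → ∀ {u} → A u → ∀ v → A v
  inClosed-full strong {A} closed {u} Au v = go (strong v u) Au
    where
      go : ∀ {w} → Star _⟶_ w u → A u → A w
      go ε Au = Au
      go (e ◅ path) Au = closed e (go path Au)

  in-neighbour : StronglyConnected G → ∀ {u v} → u ≢ v → ∃ λ w → w ⟶ v
  in-neighbour strong {u} {v} u≢v with reverse {U = λ a b → b ⟶ a} id (strong u v)
  ... | ε     = ⊥-elim (u≢v refl)
  ... | e ◅ _ = _ , e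

  module Tripartite
    (strong : StronglyConnected G) (nontrivial : 1 < N)
    (Mem : Part → Fin N → Set)
    (covers : ∀ v → ∃ λ p → Mem p v)
    (disjoint : ∀ {p q v} → Mem p v → Mem q v → p ≡ q)
    (transitive : ∀ {p q} → p ≢ q → TransitiveSet G (Mem p ∪ Mem q))
    (size : Part → ℕ) (vtx : ∀ p → Fin (size p) → Fin N)
    (enumerates : ∀ p → OrderedEnumeration G (Mem p) (vtx p))
    where

    vtx-mem : ∀ p f → Mem p (vtx p f)
    vtx-mem p = proj₁ (enumerates p)

    vtx-surjective : ∀ v → ∃₂ λ p f → vtx p f ≡ v
    vtx-surjective v with covers v
    ... | p , v∈p = p , proj₁ (proj₂ (enumerates p)) v v∈p

    ordered : ∀ p {f g} → toℕ f < toℕ g → vtx p f ⟶ vtx p g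
    ordered p = proj₂ (proj₂ (enumerates p)) _ _

    ⟶-ordered : ∀ {p f g} → vtx p f ⟶ vtx p g → toℕ f < toℕ g
    ⟶-ordered {p} {f} {g} e with <-cmp (toℕ f) (toℕ g)
    ... | tri< f<g _ _ = f<g
    ... | tri≈ _ f≡g _ =
      ⊥-elim (⟶-irrefl (subst (λ h → vtx p f ⟶ vtx p h) (sym (toℕ-injective f≡g)) e))
    ... | tri> _ _ g<f = ⊥-elim (⟶-asym e (ordered p g<f))

    part-unique : ∀ {p q f g} → vtx p f ≡ vtx q g → p ≡ q
    part-unique e = disjoint (vtx-mem _ _) (subst (Mem _) (sym e) (vtx-mem _ _))

    distinct : ∀ {p q} f g → p ≢ q → vtx p f ≢ vtx q g
    distinct _ _ p≢q = p≢q ∘ part-unique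

    raise-target : ∀ {p q f g g′} → p ≢ q → vtx p f ⟶ vtx q g → toℕ g ≤ toℕ g′ →
                   vtx p f ⟶ vtx q g′
    raise-target {p} {q} {f} {g} {g′} p≢q e g≤g′ with m≤n⇒m<n∨m≡n g≤g′
    ... | inj₂ g≡g′ = subst (λ h → vtx p f ⟶ vtx q h) (toℕ-injective g≡g′) e
    ... | inj₁ g<g′ with ⟶-connex (distinct f g′ p≢q)
    ...   | inj₁ e′ = e′
    ...   | inj₂ e′ = ⊥-elim (transitive p≢q _ _ _
                                (inj₁ (vtx-mem p f)) (inj₂ (vtx-mem q g)) (inj₂ (vtx-mem q g′))
                                (e , ordered q g<g′ , e′))

    lower-source : ∀ {p q f f′ g} → p ≢ q → vtx p f ⟶ vtx q g → toℕ f′ ≤ toℕ f →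
                   vtx p f′ ⟶ vtx q g
    lower-source {p} {q} {f} {f′} {g} p≢q e f′≤f with m≤n⇒m<n∨m≡n f′≤f
    ... | inj₂ f′≡f = subst (λ h → vtx p h ⟶ vtx q g) (sym (toℕ-injective f′≡f)) e
    ... | inj₁ f′<f with ⟶-connex (distinct f′ g p≢q)
    ...   | inj₁ e′ = e′
    ...   | inj₂ e′ = ⊥-elim (transitive p≢q _ _ _
                                (inj₁ (vtx-mem p f′)) (inj₁ (vtx-mem p f)) (inj₂ (vtx-mem q g))
                                (ordered p f′<f , e , e′))

    Beats : Part → ℕ → Part → ℕ → Set
    Beats p i q j = ∀ {f g} → toℕ f < i → j ≤ toℕ g → vtx p f ⟶ vtx q g

    beats-mono : ∀ {p q i i′ j j′} → Beats p i q j → i′ ≤ i → j ≤ j′ → Beats p i′ q j′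
    beats-mono b i′≤i j≤j′ f< ≤g = b (<-≤-trans f< i′≤i) (≤-trans j≤j′ ≤g)

    beats-edge : ∀ {p q f g} → p ≢ q → vtx p f ⟶ vtx q g → Beats p (suc (toℕ f)) q (toℕ g)
    beats-edge p≢q e (s≤s f′≤f) g≤g′ = lower-source p≢q (raise-target p≢q e g≤g′) f′≤f

    beats-at : ∀ {p q i j} → p ≢ q → .(h : i < size p) .(k : j < size q) →
               vtx p (fromℕ< h) ⟶ vtx q (fromℕ< k) → Beats p (suc i) q j
    beats-at p≢q h k e = beats-mono (beats-edge p≢q e)
      (s≤s (≤-reflexive (sym (toℕ-fromℕ< h)))) (≤-reflexive (toℕ-fromℕ< k))

    edge-at : ∀ {p q i j} → Beats p (suc i) q j → .(h : i < size p) .(k : j < size q) →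
              vtx p (fromℕ< h) ⟶ vtx q (fromℕ< k)
    edge-at b h k = b (s≤s (≤-reflexive (toℕ-fromℕ< h))) (≤-reflexive (sym (toℕ-fromℕ< k)))

    Prefix : (Part → ℕ) → Fin N → Set
    Prefix t v = ∃₂ λ p f → toℕ f < t p × vtx p f ≡ v

    prefix-inClosed : ∀ {t} → (∀ {p q} → p ≢ q → Beats p (t p) q (t q)) → InClosed (Prefix t)
    prefix-inClosed {t} beats {u} u⟶v (p , f , f< , refl) with vtx-surjective u
    ... | q , g , refl with toℕ g <? t q
    ...   | yes g< = q , g , g< , refl
    ...   | no  g≮ with p ≟ q
    ...     | yes refl = ⊥-elim (⟶-asym u⟶v (ordered p (<-≤-trans f< (≮⇒≥ g≮))))
    ...     | no  p≢q  = ⊥-elim (⟶-asym u⟶v (beats p≢q f< (≮⇒≥ g≮)))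

    prefix-excludes : ∀ {t q g} → t q ≤ toℕ g → ¬ Prefix t (vtx q g)
    prefix-excludes g≥ (p , f , f< , e) with part-unique e
    ... | refl = ⟶-irrefl (subst (vtx p f ⟶_) (sym e) (ordered p (<-≤-trans f< g≥)))

    Leads : Part → Part → Set
    Leads q p = 0 < size q × 0 < size p × Beats q 1 p 0

    leads-asym : ∀ {p q} → Leads p q → ¬ Leads q p
    leads-asym (p≠∅ , q≠∅ , b) (_ , _ , b′) = ⟶-asym (edge-at b p≠∅ q≠∅) (edge-at b′ q≠∅ p≠∅)

    first-beaten : ∀ {c} → 0 < size c → ∃ λ q → q ≢ c × Leads q c
    first-beaten {c} c≠∅ with another nontrivial (vtx c (fromℕ< c≠∅))
    ... | _ , u≢ with in-neighbour strong u≢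
    ...   | w , w⟶ with vtx-surjective w
    ...     | q , g , refl with q ≟ c
    ...       | yes refl = ⊥-elim (n≮0 (subst (toℕ g <_) (toℕ-fromℕ< c≠∅) (⟶-ordered w⟶)))
    ...       | no  q≢c  = q , q≢c , ≤-<-trans z≤n (toℕ<n g) , c≠∅ ,
                           beats-mono (beats-edge q≢c w⟶) (s≤s z≤n) (≤-reflexive (toℕ-fromℕ< c≠∅))

    -- Some first vertex beats that of turn o c; it is not c's, which is beaten by it.
    propagate : ∀ {o c} → Leads (turn o c) c → Leads (turn o (turn o c)) (turn o c)
    propagate {o} {c} lead with first-beaten (proj₁ lead)
    ... | q , q≢ , q-leads =
      orbit-elim o c
        {λ q → q ≢ turn o c → Leads q (turn o c) → Leads (turn o (turn o c)) (turn o c)}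
        (λ _ l → ⊥-elim (leads-asym lead l)) (λ q≢q _ → ⊥-elim (q≢q refl)) (λ _ l → l)
        q q≢ q-leads

    -- oriented is the monotone form of the edge between two corners (see beats-edge); it is this
    -- form that survives a bump.
    record Cyclic (o : Orientation) (t : Part → ℕ) : Set where
      field
        bounded  : ∀ p → t p < size p
        oriented : ∀ p → Beats (turn o p) (suc (t (turn o p))) p (t p)

    initial : ∃ λ o → Cyclic o (λ _ → 0)
    initial with vtx-surjective (fromℕ< (≤-<-trans z≤n nontrivial))
    ... | c , f , _ with first-beaten (≤-<-trans z≤n (toℕ<n f))
    ...   | q , q≢c , q-leads =
      let o , l = others-elim c {λ q → Leads q c → ∃ λ o → Leads (turn o c) c}
                    (λ o l → o , l) q q≢c q-leads
          leads  = orbit-elim o c {λ p → Leads (turn o p) p} l (propagate l) (propagate (propagate l))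
      in o , record { bounded  = λ p → proj₁ (proj₂ (leads p))
                    ; oriented = λ p → proj₂ (proj₂ (leads p)) }

    open Cyclic

    corner-edge : ∀ {o t} (c : Cyclic o t) p →
                  vtx (turn o p) (fromℕ< (bounded c (turn o p))) ⟶ vtx p (fromℕ< (bounded c p))
    corner-edge c p = edge-at (oriented c p) (bounded c _) (bounded c p)

    triangle : ∀ {o t} → Cyclic o t → CyclicAt G (vtx 𝒳) (vtx 𝒴) (vtx 𝒵) (triple t)
    triangle {clockwise} c =
      bounded c 𝒳 , bounded c 𝒴 , bounded c 𝒵 ,
      inj₂ (corner-edge c 𝒵 , corner-edge c 𝒴 , corner-edge c 𝒳)
    triangle {anticlockwise} c =
      bounded c 𝒳 , bounded c 𝒴 , bounded c 𝒵 ,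
      inj₁ (corner-edge c 𝒴 , corner-edge c 𝒵 , corner-edge c 𝒳)

    Movable : (Part → ℕ) → Part → Set
    Movable t p = suc (t p) < size p

    module _ {o t} (c : Cyclic o t) where

      advance-or-block : ∀ q →
        (Movable t (turn o q) × Beats (turn o q) (2 + t (turn o q)) q (t q)) ⊎
        Beats q (suc (t q)) (turn o q) (suc (t (turn o q)))
      advance-or-block q with suc (t (turn o q)) <? size (turn o q)
      ... | no  full = inj₂ λ _ g≥ → ⊥-elim (full (≤-<-trans g≥ (toℕ<n _)))
      ... | yes m with ⟶-connex (distinct (fromℕ< m) (fromℕ< (bounded c q)) (turn-irrefl o q))
      ...   | inj₁ e = inj₁ (m , beats-at (turn-irrefl o q) m (bounded c q) e)
      ...   | inj₂ e = inj₂ (beats-at (turn-irrefl o q ∘ sym) (bounded c q) m e)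

      advance : ∀ {q} → Movable t (turn o q) → Beats (turn o q) (2 + t (turn o q)) q (t q) →
                Cyclic o (bump (turn o q) t)
      advance {q} m b = record { bounded = bounded′ ; oriented = oriented′ }
        where
          p = turn o q
          bounded′ : ∀ r → bump p t r < size r
          bounded′ r with r ≟ p
          ... | yes refl = subst (_< size p) (sym (bump-self p t)) m
          ... | no  r≢p  = subst (_< size r) (sym (bump-other t (r≢p ∘ sym))) (bounded c r)
          oriented′ : ∀ r → Beats (turn o r) (suc (bump p t (turn o r))) r (bump p t r)
          oriented′ r with r ≟ q
          ... | yes refl = beats-mono b (≤-reflexive (cong suc (bump-self p t))) (bump-≥ p t q)
          ... | no  r≢q  = beats-mono (oriented c r)
                  (≤-reflexive (cong suc (bump-other t (r≢q ∘ sym ∘ turn-injective o))))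
                  (bump-≥ p t r)

      blocked-absurd : ∀ {q} → Movable t q →
                       ¬ (∀ p → Beats p (suc (t p)) (turn o p) (suc (t (turn o p))))
      blocked-absurd {q} m blocked =
        prefix-excludes {g = fromℕ< m} (≤-reflexive (sym (toℕ-fromℕ< m)))
          (inClosed-full strong (prefix-inClosed beats) inside (vtx q (fromℕ< m)))
        where
          inside : Prefix (suc ∘ t) (vtx q (fromℕ< (bounded c q)))
          inside = q , fromℕ< (bounded c q) , s≤s (≤-reflexive (toℕ-fromℕ< (bounded c q))) , refl
          beats : ∀ {p r} → p ≢ r → Beats p (suc (t p)) r (suc (t r))
          beats {p} {r} p≢r with adjacent o p≢r
          ... | inj₁ refl = blocked p
          ... | inj₂ refl = beats-mono (oriented c r) ≤-refl (n≤1+n _)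

      step : ∃ (Movable t) → ∃ λ p → Cyclic o (bump p t)
      step (_ , m) with any-or-all advance-or-block
      ... | inj₁ (q , m′ , b) = turn o q , advance m′ b
      ... | inj₂ blocked      = ⊥-elim (blocked-absurd m blocked)

    flatten : Fin (total size) → Fin N
    flatten = [ vtx 𝒳 , [ vtx 𝒴 , vtx 𝒵 ]′ ∘ splitAt (size 𝒴) ]′ ∘ splitAt (size 𝒳)

    embed : ∀ p → Fin (size p) → Fin (total size)
    embed 𝒳 f = f ↑ˡ (size 𝒴 + size 𝒵)
    embed 𝒴 f = size 𝒳 ↑ʳ (f ↑ˡ size 𝒵)
    embed 𝒵 f = size 𝒳 ↑ʳ (size 𝒴 ↑ʳ f)

    flatten-embed : ∀ p f → flatten (embed p f) ≡ vtx p f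
    flatten-embed 𝒳 f rewrite splitAt-↑ˡ (size 𝒳) f (size 𝒴 + size 𝒵) = refl
    flatten-embed 𝒴 f rewrite splitAt-↑ʳ (size 𝒳) (size 𝒴 + size 𝒵) (f ↑ˡ size 𝒵)
                            | splitAt-↑ˡ (size 𝒴) f (size 𝒵) = refl
    flatten-embed 𝒵 f rewrite splitAt-↑ʳ (size 𝒳) (size 𝒴 + size 𝒵) (size 𝒴 ↑ʳ f)
                            | splitAt-↑ʳ (size 𝒴) (size 𝒵) f = refl

    vertex-count : N ≤ total size
    vertex-count = surjection⇒≥ flatten λ v →
      let p , f , e = vtx-surjective v in embed p f , trans (flatten-embed p f) e

    module Walk (o : Orientation) (start : Cyclic o (λ _ → 0)) where

      State : Set
      State = Σ (Part → ℕ) (Cyclic o)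

      movable-or-full : ∀ t p → Movable t p ⊎ size p ≤ suc (t p)
      movable-or-full t p with suc (t p) <? size p
      ... | yes m = inj₁ m
      ... | no ¬m = inj₂ (≮⇒≥ ¬m)

      full-bound : ∀ {t} → (∀ p → size p ≤ suc (t p)) → N ≤ 3 + total t
      full-bound {t} full =
        ≤-trans vertex-count (≤-trans (total-mono full) (≤-reflexive (total-suc t)))

      -- A walk that cannot advance stands still; by full-bound this happens only beyond the range
      -- of the theorem.
      next : State → State
      next (t , c) with any-or-all (movable-or-full t)
      ... | inj₁ m = let p , c′ = step c m in bump p t , c′
      ... | inj₂ _ = t , c

      next-bumps : ∀ s → 3 + total (proj₁ s) < N → ∃ λ p → proj₁ (next s) ≡ bump p (proj₁ s)
      next-bumps (t , c) room with any-or-all (movable-or-full t)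
      ... | inj₁ m    = proj₁ (step c m) , refl
      ... | inj₂ full = ⊥-elim (<⇒≱ room (full-bound full))

      walk : ℕ → State
      walk zero    = (λ _ → 0) , start
      walk (suc r) = next (walk r)

      walk-total : ∀ r → 3 + r ≤ N → total (proj₁ (walk r)) ≡ r
      walk-bumps : ∀ r → 4 + r ≤ N → ∃ λ p → proj₁ (walk (suc r)) ≡ bump p (proj₁ (walk r))

      walk-total zero    _    = refl
      walk-total (suc r) room =
        let p , eq = walk-bumps r room
        in trans (cong total eq)
                 (trans (total-bump p _) (cong suc (walk-total r (≤-trans (n≤1+n _) room))))

      walk-bumps r room = next-bumps (walk r)
        (subst (λ k → 3 + k < N) (sym (walk-total r (≤-trans (n≤1+n _) room))) room)

      walk-step : ∀ r → 4 + r ≤ N → Step (triple (proj₁ (walk r))) (triple (proj₁ (walk (suc r))))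
      walk-step r room =
        let p , eq = walk-bumps r room
        in subst (Step (triple (proj₁ (walk r))) ∘ triple) (sym eq) (bump-step p _)

module Partition3-Parts
  {N : ℕ} (G : Tournament N) {X Y Z : Fin N → Set} (partition : Partition3 X Y Z)
  (XY-transitive : TransitiveSet G (X ∪ Y)) (YZ-transitive : TransitiveSet G (Y ∪ Z))
  (ZX-transitive : TransitiveSet G (Z ∪ X))
  {ℓ m n : ℕ} (x : Fin ℓ → Fin N) (y : Fin m → Fin N) (z : Fin n → Fin N)
  (x-enum : OrderedEnumeration G X x) (y-enum : OrderedEnumeration G Y y)
  (z-enum : OrderedEnumeration G Z z)
  where

  Mem : Part → Fin N → Set
  Mem 𝒳 = X
  Mem 𝒴 = Y
  Mem 𝒵 = Z

  size : Part → ℕ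
  size 𝒳 = ℓ
  size 𝒴 = m
  size 𝒵 = n

  vtx : ∀ p → Fin (size p) → Fin N
  vtx 𝒳 = x
  vtx 𝒴 = y
  vtx 𝒵 = z

  enumerates : ∀ p → OrderedEnumeration G (Mem p) (vtx p)
  enumerates 𝒳 = x-enum
  enumerates 𝒴 = y-enum
  enumerates 𝒵 = z-enum

  private
    cover = proj₁ partition
    X∩Y = proj₁ (proj₂ partition)
    Y∩Z = proj₁ (proj₂ (proj₂ partition))
    Z∩X = proj₂ (proj₂ (proj₂ partition))

    ∪-transitive-comm : ∀ {A B} → TransitiveSet G (A ∪ B) → TransitiveSet G (B ∪ A)
    ∪-transitive-comm t a b c a∈ b∈ c∈ = t a b c (swap a∈) (swap b∈) (swap c∈)

  covers : ∀ v → ∃ λ p → Mem p v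
  covers v with cover v
  ... | inj₁ v∈X        = 𝒳 , v∈X
  ... | inj₂ (inj₁ v∈Y) = 𝒴 , v∈Y
  ... | inj₂ (inj₂ v∈Z) = 𝒵 , v∈Z

  disjoint : ∀ {p q v} → Mem p v → Mem q v → p ≡ q
  disjoint {𝒳} {𝒳} _ _ = refl
  disjoint {𝒴} {𝒴} _ _ = refl
  disjoint {𝒵} {𝒵} _ _ = refl
  disjoint {𝒳} {𝒴} a b = ⊥-elim (X∩Y _ a b)
  disjoint {𝒴} {𝒳} a b = ⊥-elim (X∩Y _ b a)
  disjoint {𝒴} {𝒵} a b = ⊥-elim (Y∩Z _ a b)
  disjoint {𝒵} {𝒴} a b = ⊥-elim (Y∩Z _ b a)
  disjoint {𝒵} {𝒳} a b = ⊥-elim (Z∩X _ a b)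
  disjoint {𝒳} {𝒵} a b = ⊥-elim (Z∩X _ b a)

  transitive : ∀ {p q} → p ≢ q → TransitiveSet G (Mem p ∪ Mem q)
  transitive {𝒳} {𝒴} _ = XY-transitive
  transitive {𝒴} {𝒵} _ = YZ-transitive
  transitive {𝒵} {𝒳} _ = ZX-transitive
  transitive {𝒴} {𝒳} _ = ∪-transitive-comm XY-transitive
  transitive {𝒵} {𝒴} _ = ∪-transitive-comm YZ-transitive
  transitive {𝒳} {𝒵} _ = ∪-transitive-comm ZX-transitive
  transitive {𝒳} {𝒳} p≢p = ⊥-elim (p≢p refl)
  transitive {𝒴} {𝒴} p≢p = ⊥-elim (p≢p refl)
  transitive {𝒵} {𝒵} p≢p = ⊥-elim (p≢p refl)

proposition4p2 : (N : ℕ) → 3 ≤ N → (G : Tournament N) → StronglyConnected G →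
    (X Y Z : Fin N → Set) → Partition3 X Y Z →
    TransitiveSet G (X ∪ Y) → TransitiveSet G (Y ∪ Z) → TransitiveSet G (Z ∪ X) →
    (ℓ m n : ℕ) (x : Fin ℓ → Fin N) (y : Fin m → Fin N) (z : Fin n → Fin N) →
    OrderedEnumeration G X x → OrderedEnumeration G Y y → OrderedEnumeration G Z z →
    Σ (ℕ → ℕ × ℕ × ℕ) λ C →
    (C 0 ≡ (0 , 0 , 0)) ×
    (∀ r → r < N ∸ 2 → CyclicAt G x y z (C r)) ×
    (∀ r → suc r < N ∸ 2 → Step (C r) (C (suc r)))
proposition4p2 (suc (suc _)) _ G strong _ _ _ partition tXY tYZ tZX _ _ _ x y z ex ey ez =
  triple ∘ proj₁ ∘ walk , refl ,
  (λ r _ → triangle (proj₂ (walk r))) ,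
  (λ r r+1< → walk-step r (s≤s (s≤s r+1<)))
  where
    open Partition3-Parts G partition tXY tYZ tZX x y z ex ey ez
    open Tripartite G strong (s≤s (s≤s z≤n)) Mem covers disjoint transitive size vtx enumerates
    open Walk (proj₁ initial) (proj₂ initial)
proposition4p2 (suc zero) (s≤s ()) _ _ _ _ _ _ _ _ _ _ _ _ _ _ _ _ _
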